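{- For $n\ge0$, let $\rho_c(n)$ denote the number of partitions of $n$ in which the largest part $\lambda$ appears exactly once and the remaining parts form a cubic partition of $\lambda$. Then, as formal power series (equivalently for $|q|<1$), $$\sum_{n=0}^{\infty}\rho_{c}(n)q^n=\frac{1}{(q^2;q^2)_\infty(q^4;q^4)_\infty}-\frac{2}{1-q^2}+\frac{q^6}{1-q^4}+1+q^2.$$
   Context: For $|q|<1$, $(a;q)_\infty=\prod_{k=0}^{\infty}(1-aq^k)$. A cubic partition of $m$ is a partition of $m$ in which each even part may occur in one of two distinct colours (odd parts have a single colour); their number $a(m)$ satisfies $\sum_{m\ge0}a(m)q^m=1/((q;q)_\infty(q^2;q^2)_\infty)$. Since the largest part $\lambda$ appears exactly once, all remaining parts have size strictly less than $\lambda$, and $n=2\lambda$. The empty partition has no largest part, so $\rho_c(0)=0$. -}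

module Defs where

open import Data.Nat as ℕ using (ℕ; zero; suc; _≤_; _<_; _≤ᵇ_; _<ᵇ_; _≡ᵇ_; _%_; NonZero)
open import Data.Integer as ℤ using (ℤ; +_; -_)
open import Data.Bool using (Bool; true; false; T; _∧_; _∨_; not; if_then_else_)
open import Data.Product using (_×_; _,_; proj₁)
open import Data.List using (List; []; _∷_)
open import Data.List.Relation.Unary.All using (All)
open import Relation.Binary.PropositionalEquality using (_≡_)

Series : Set
Series = ℕ → ℤ

sumTo : ℕ → (ℕ → ℤ) → ℤ
sumTo zero    h = h zero
sumTo (suc n) h = sumTo n h ℤ.+ h (suc n)

mono : ℕ → Series
mono k n = if n ≡ᵇ k then + 1 else + 0

one : Series
one = mono 0

infixl 6 _⊕_ _⊖_
infixl 7 _⊛_ _⊙_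

_⊕_ : Series → Series → Series
(f ⊕ g) n = f n ℤ.+ g n

_⊖_ : Series → Series → Series
(f ⊖ g) n = f n ℤ.- g n

_⊙_ : ℤ → Series → Series
(c ⊙ f) n = c ℤ.* f n

_⊛_ : Series → Series → Series
(f ⊛ g) n = sumTo n (λ i → f i ℤ.* g (n ℕ.∸ i))

prodFrom1 : (ℕ → Series) → ℕ → Series
prodFrom1 F zero    = one
prodFrom1 F (suc N) = prodFrom1 F N ⊛ F (suc N)

-- (q^m;q^m)_∞ = ∏_{k≥1} (1 - q^{mk}), for m ≥ 1.  Its coefficient of q^n
-- only depends on the factors with k ≤ n, so it is the n-th coefficient of
-- the finite product ∏_{k=1}^{n} (1 - q^{mk}).
qPoch : (m : ℕ) → .{{NonZero m}} → Series
qPoch m n = prodFrom1 (λ k → one ⊖ mono (m ℕ.* k)) n n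

-- Multiplicative inverse of a power series f with constant term f 0 = 1:
-- b 0 = 1,  b (n+1) = - Σ_{k=1}^{n+1} f k * b (n+1-k).
-- invUpTo f n i is correct for all i ≤ n.
invUpTo : Series → ℕ → Series
invUpTo f zero    i = one i
invUpTo f (suc n) i =
  if i ≤ᵇ n then invUpTo f n i
  else - sumTo n (λ j → f (suc j) ℤ.* invUpTo f n (n ℕ.∸ j))

inv1 : Series → Series
inv1 f n = invUpTo f n n

rhs : Series
rhs = inv1 (qPoch 2 ⊛ qPoch 4)
      ⊖ (+ 2) ⊙ inv1 (one ⊖ mono 2)
      ⊕ mono 6 ⊛ inv1 (one ⊖ mono 4)
      ⊕ one
      ⊕ mono 2

-- Cubic partitions.
-- A coloured part is (size , colour).  Odd parts have only one colour
-- (false); even parts may have colour false or true.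

ColPart : Set
ColPart = ℕ × Bool

isOdd : ℕ → Bool
isOdd s = (s % 2) ≡ᵇ 1

validPart : ColPart → Bool
validPart (s , c) = (1 ≤ᵇ s) ∧ (not (isOdd s) ∨ not c)

allValid : List ColPart → Bool
allValid []       = true
allValid (x ∷ xs) = validPart x ∧ allValid xs

_≤Bᵇ_ : Bool → Bool → Bool
false ≤Bᵇ _    = true
true  ≤Bᵇ true = true
true  ≤Bᵇ false = false

_≤Pᵇ_ : ColPart → ColPart → Bool
(t , d) ≤Pᵇ (s , c) = (t <ᵇ s) ∨ ((t ≡ᵇ s) ∧ (d ≤Bᵇ c))

-- non-increasing in the lexicographic order (canonical multiset representation)
nonIncr : List ColPart → Bool
nonIncr []           = true
nonIncr (x ∷ [])     = true
nonIncr (x ∷ y ∷ xs) = (y ≤Pᵇ x) ∧ nonIncr (y ∷ xs)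

sizeSum : List ColPart → ℕ
sizeSum []            = 0
sizeSum ((s , _) ∷ xs) = s ℕ.+ sizeSum xs

IsCubicPartition : ℕ → List ColPart → Set
IsCubicPartition m xs = T (allValid xs ∧ nonIncr xs) × sizeSum xs ≡ m

record RhoC (n : ℕ) : Set where
  constructor mkRhoC
  field
    largest     : ℕ
    rest        : List ColPart
    largest-pos : 1 ≤ largest
    cubic       : IsCubicPartition largest rest
    below       : All (λ p → proj₁ p < largest) rest
    total       : n ≡ largest ℕ.+ sizeSum rest

{-# OPTIONS --safe #-}

-- Number coloured parts by code (s , c) = 2s + [c], an order isomorphism from the
-- lexicographic order used by nonIncr onto ℕ.  Splitting off a largest part shows that the
-- cubic partitions of n/2 whose parts all have code ≤ β are counted by the coefficient of qⁿ
-- in the inverse of ∏ (1 - q^(2s)), the product over the valid parts (s , c) of code ≤ β.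
-- Each size s contributes one factor, even sizes a second one, so for β = 4n + 1 this product
-- agrees with (q²;q²)_∞ (q⁴;q⁴)_∞ up to qⁿ.  A partition counted by ρ_c(2λ) is a cubic
-- partition of λ with all parts below λ, i.e. with all codes below 2λ; the other cubic
-- partitions of λ are the single part λ in its one or two admissible colours (and the empty
-- partition when λ = 0).  These are counted by 2/(1-q²) - q⁶/(1-q⁴) - 1 - q².
module Submission where

open import Defs
open import Data.Bool using (true; false; T; if_then_else_; _∧_; _∨_; not)
open import Data.Bool.Properties using (T-∧; T-irrelevant; ∨-zeroʳ)
open import Data.Fin as Fin using (Fin)
open import Data.Fin.Permutation using (↔⇒≡)
open import Data.Fin.Properties using (+↔⊎)
open import Data.Integer using (ℤ; +_; -_)
import Data.Integer.Properties as ℤ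
open import Data.Integer.Tactic.RingSolver using (solve-∀)
open import Data.List using (List; []; _∷_)
import Data.List.Properties as List
open import Data.List.Relation.Unary.All as All using (All; []; _∷_)
open import Data.Nat as ℕ using (ℕ; zero; suc; _∸_; _≤_; _<_; z≤n; s≤s; _≤?_; _≤ᵇ_; _%_; NonZero)
open import Data.Nat.DivMod using (m≤n⇒[n∸m]%m≡n%m; m<n⇒m%n≡m; m*n%n≡0; [m+kn]%n≡m%n)
open import Data.Nat.Induction using (<-rec)
import Data.Nat.Properties as ℕ
import Data.Nat.Tactic.RingSolver as ℕ-Solver
open import Data.Product using (Σ; ∃; _×_; _,_; proj₁; proj₂; map₁)
open import Data.Sum using (_⊎_; inj₁; inj₂; [_,_])
open import Data.Sum.Function.Propositional using (_⊎-↔_)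
open import Data.Unit using (⊤; tt)
open import Function using (_∘_)
open import Function.Bundles using (_↔_; Equivalence; mk⤖; mk↔ₛ′)
open import Function.Consequences.Propositional using (strictlySurjective⇒surjective)
open import Function.Definitions using (Injective)
open import Function.Properties.Bijection using (⤖⇒↔)
open import Function.Properties.Inverse using (↔-trans; ↔-sym)
open import Relation.Binary.PropositionalEquality hiding ([_])
open import Relation.Nullary using (¬_; Dec; yes; no; contradiction)
open import Relation.Nullary.Decidable using (T?; _×-dec_)

module PowerSeries where

  open import Data.Integer using (_+_; _-_; _*_)
  open import Algebra.Properties.AbelianGroup ℤ.+-0-abelianGroup using (inverseˡ-unique)
  open ≡-Reasoning

  infix 4 _≈_ _≈[_]_

  _≈_ : Series → Series → Set
  f ≈ g = ∀ n → f n ≡ g n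

  _≈[_]_ : Series → ℕ → Series → Set
  f ≈[ N ] g = ∀ i → i ≤ N → f i ≡ g i

  shift : Series → Series
  shift f n = f (suc n)

  sumTo-cong : ∀ n {f g : ℕ → ℤ} → (∀ i → i ≤ n → f i ≡ g i) → sumTo n f ≡ sumTo n g
  sumTo-cong zero    f≡g = f≡g 0 z≤n
  sumTo-cong (suc n) f≡g =
    cong₂ _+_ (sumTo-cong n (λ i i≤n → f≡g i (ℕ.m≤n⇒m≤1+n i≤n))) (f≡g (suc n) ℕ.≤-refl)

  sumTo-zero : ∀ n → sumTo n (λ _ → + 0) ≡ + 0
  sumTo-zero zero    = refl
  sumTo-zero (suc n) = cong (_+ + 0) (sumTo-zero n)

  sumTo-+ : ∀ n (f g : ℕ → ℤ) → sumTo n (λ i → f i + g i) ≡ sumTo n f + sumTo n g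
  sumTo-+ zero    f g = refl
  sumTo-+ (suc n) f g = begin
    sumTo n (λ i → f i + g i) + (f (suc n) + g (suc n))
      ≡⟨ cong (_+ (f (suc n) + g (suc n))) (sumTo-+ n f g) ⟩
    (sumTo n f + sumTo n g) + (f (suc n) + g (suc n))
      ≡⟨ interchange (sumTo n f) (sumTo n g) (f (suc n)) (g (suc n)) ⟩
    (sumTo n f + f (suc n)) + (sumTo n g + g (suc n)) ∎
    where
    interchange : ∀ a b c d → (a + b) + (c + d) ≡ (a + c) + (b + d)
    interchange = solve-∀

  sumTo-*ˡ : ∀ n c (f : ℕ → ℤ) → sumTo n (λ i → c * f i) ≡ c * sumTo n f
  sumTo-*ˡ zero    c f = refl
  sumTo-*ˡ (suc n) c f = trans (cong (_+ c * f (suc n)) (sumTo-*ˡ n c f))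
                               (sym (ℤ.*-distribˡ-+ c (sumTo n f) (f (suc n))))

  sumTo-neg : ∀ n (f : ℕ → ℤ) → sumTo n (λ i → - f i) ≡ - sumTo n f
  sumTo-neg zero    f = refl
  sumTo-neg (suc n) f = trans (cong (_+ - f (suc n)) (sumTo-neg n f))
                              (sym (ℤ.neg-distrib-+ (sumTo n f) (f (suc n))))

  sumTo-sucˡ : ∀ n (f : ℕ → ℤ) → sumTo (suc n) f ≡ f 0 + sumTo n (λ i → f (suc i))
  sumTo-sucˡ zero    f = refl
  sumTo-sucˡ (suc n) f = trans (cong (_+ f (suc (suc n))) (sumTo-sucˡ n f))
                               (ℤ.+-assoc (f 0) (sumTo n (λ i → f (suc i))) (f (suc (suc n))))

  sumTo-reverse : ∀ n (f : ℕ → ℤ) → sumTo n f ≡ sumTo n (λ i → f (n ∸ i))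
  sumTo-reverse zero    f = refl
  sumTo-reverse (suc n) f = begin
    sumTo n f + f (suc n)                  ≡⟨ cong (_+ f (suc n)) (sumTo-reverse n f) ⟩
    sumTo n (λ i → f (n ∸ i)) + f (suc n)  ≡⟨ ℤ.+-comm (sumTo n (λ i → f (n ∸ i))) (f (suc n)) ⟩
    f (suc n) + sumTo n (λ i → f (n ∸ i))  ≡⟨ sym (sumTo-sucˡ n (λ i → f (suc n ∸ i))) ⟩
    sumTo (suc n) (λ i → f (suc n ∸ i))    ∎

  ⊛-suc : ∀ f g n → (f ⊛ g) (suc n) ≡ f 0 * g (suc n) + (shift f ⊛ g) n
  ⊛-suc f g n = sumTo-sucˡ n (λ i → f i * g (suc n ∸ i))

  ⊛-congˡ : ∀ {f f′} g → f ≈ f′ → f ⊛ g ≈ f′ ⊛ g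
  ⊛-congˡ g f≈f′ n = sumTo-cong n (λ i _ → cong (_* g (n ∸ i)) (f≈f′ i))

  ⊛-congʳ : ∀ f {g g′} → g ≈ g′ → f ⊛ g ≈ f ⊛ g′
  ⊛-congʳ f g≈g′ n = sumTo-cong n (λ i _ → cong (f i *_) (g≈g′ (n ∸ i)))

  ⊛-cong-≈[] : ∀ {N f f′ g g′} → f ≈[ N ] f′ → g ≈[ N ] g′ → f ⊛ g ≈[ N ] f′ ⊛ g′
  ⊛-cong-≈[] f≈f′ g≈g′ n n≤N = sumTo-cong n (λ i i≤n →
    cong₂ _*_ (f≈f′ i (ℕ.≤-trans i≤n n≤N)) (g≈g′ (n ∸ i) (ℕ.≤-trans (ℕ.m∸n≤m n i) n≤N)))

  ⊛-comm : ∀ f g → f ⊛ g ≈ g ⊛ f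
  ⊛-comm f g n = begin
    sumTo n (λ i → f i * g (n ∸ i))              ≡⟨ sumTo-reverse n _ ⟩
    sumTo n (λ i → f (n ∸ i) * g (n ∸ (n ∸ i)))  ≡⟨ sumTo-cong n swap ⟩
    sumTo n (λ i → g i * f (n ∸ i))              ∎
    where
    swap : ∀ i → i ≤ n → f (n ∸ i) * g (n ∸ (n ∸ i)) ≡ g i * f (n ∸ i)
    swap i i≤n = trans (cong (λ j → f (n ∸ i) * g j) (ℕ.m∸[m∸n]≡n i≤n)) (ℤ.*-comm (f (n ∸ i)) (g i))

  ⊛-distribʳ-⊕ : ∀ f g h → (f ⊕ g) ⊛ h ≈ f ⊛ h ⊕ g ⊛ h
  ⊛-distribʳ-⊕ f g h n = trans
    (sumTo-cong n (λ i _ → ℤ.*-distribʳ-+ (h (n ∸ i)) (f i) (g i)))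
    (sumTo-+ n (λ i → f i * h (n ∸ i)) (λ i → g i * h (n ∸ i)))

  ⊛-distribʳ-⊖ : ∀ f g h → (f ⊖ g) ⊛ h ≈ f ⊛ h ⊖ g ⊛ h
  ⊛-distribʳ-⊖ f g h n = begin
    sumTo n (λ i → (f i - g i) * h (n ∸ i))
      ≡⟨ sumTo-cong n (λ i _ → distrib (f i) (g i) (h (n ∸ i))) ⟩
    sumTo n (λ i → f i * h (n ∸ i) + - (g i * h (n ∸ i)))
      ≡⟨ sumTo-+ n _ _ ⟩
    (f ⊛ h) n + sumTo n (λ i → - (g i * h (n ∸ i)))
      ≡⟨ cong (λ x → (f ⊛ h) n + x) (sumTo-neg n _) ⟩
    (f ⊛ h) n - (g ⊛ h) n ∎
    where
    distrib : ∀ a b c → (a - b) * c ≡ a * c + - (b * c)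
    distrib = solve-∀

  ⊙-⊛ : ∀ c f g → (c ⊙ f) ⊛ g ≈ c ⊙ (f ⊛ g)
  ⊙-⊛ c f g n = trans
    (sumTo-cong n (λ i _ → ℤ.*-assoc c (f i) (g (n ∸ i))))
    (sumTo-*ˡ n c (λ i → f i * g (n ∸ i)))

  ⊛-assoc : ∀ f g h → (f ⊛ g) ⊛ h ≈ f ⊛ (g ⊛ h)
  ⊛-assoc f g h zero    = ℤ.*-assoc (f 0) (g 0) (h 0)
  ⊛-assoc f g h (suc n) = begin
    ((f ⊛ g) ⊛ h) (suc n)
      ≡⟨ ⊛-suc (f ⊛ g) h n ⟩
    a * b * h (suc n) + (shift (f ⊛ g) ⊛ h) n
      ≡⟨ cong (λ x → a * b * h (suc n) + x) (⊛-congˡ h (⊛-suc f g) n) ⟩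
    a * b * h (suc n) + ((a ⊙ shift g ⊕ shift f ⊛ g) ⊛ h) n
      ≡⟨ cong (λ x → a * b * h (suc n) + x) (⊛-distribʳ-⊕ (a ⊙ shift g) (shift f ⊛ g) h n) ⟩
    a * b * h (suc n) + (((a ⊙ shift g) ⊛ h) n + ((shift f ⊛ g) ⊛ h) n)
      ≡⟨ cong₂ (λ x y → a * b * h (suc n) + (x + y)) (⊙-⊛ a (shift g) h n) (⊛-assoc (shift f) g h n) ⟩
    a * b * h (suc n) + (a * (shift g ⊛ h) n + (shift f ⊛ (g ⊛ h)) n)
      ≡⟨ regroup a b (h (suc n)) ((shift g ⊛ h) n) ((shift f ⊛ (g ⊛ h)) n) ⟩
    a * (b * h (suc n) + (shift g ⊛ h) n) + (shift f ⊛ (g ⊛ h)) n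
      ≡⟨ cong (λ x → a * x + (shift f ⊛ (g ⊛ h)) n) (sym (⊛-suc g h n)) ⟩
    a * (g ⊛ h) (suc n) + (shift f ⊛ (g ⊛ h)) n
      ≡⟨ sym (⊛-suc f (g ⊛ h) n) ⟩
    (f ⊛ (g ⊛ h)) (suc n) ∎
    where
    a = f 0
    b = g 0
    regroup : ∀ a b c x y → a * b * c + (a * x + y) ≡ a * (b * c + x) + y
    regroup = solve-∀

  ⊛-zeroˡ : ∀ f → (λ _ → + 0) ⊛ f ≈ (λ _ → + 0)
  ⊛-zeroˡ f n = trans (sumTo-cong n (λ i _ → ℤ.*-zeroˡ (f (n ∸ i)))) (sumTo-zero n)

  mono-⊛-≤ : ∀ {w n} f → w ≤ n → (mono w ⊛ f) n ≡ f (n ∸ w)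
  mono-⊛-≤ {zero} {zero} f _ = ℤ.*-identityˡ (f 0)
  mono-⊛-≤ {zero} {suc n} f _ = begin
    (mono 0 ⊛ f) (suc n)               ≡⟨ ⊛-suc (mono 0) f n ⟩
    + 1 * f (suc n) + (shift one ⊛ f) n ≡⟨ cong₂ _+_ (ℤ.*-identityˡ (f (suc n))) (⊛-zeroˡ f n) ⟩
    f (suc n) + + 0                     ≡⟨ ℤ.+-identityʳ (f (suc n)) ⟩
    f (suc n)                           ∎
  mono-⊛-≤ {suc w} {suc n} f (s≤s w≤n) = begin
    (mono (suc w) ⊛ f) (suc n)       ≡⟨ ⊛-suc (mono (suc w)) f n ⟩
    + 0 * f (suc n) + (mono w ⊛ f) n ≡⟨ cong₂ _+_ (ℤ.*-zeroˡ (f (suc n))) (mono-⊛-≤ f w≤n) ⟩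
    + 0 + f (n ∸ w)                  ≡⟨ ℤ.+-identityˡ (f (n ∸ w)) ⟩
    f (n ∸ w)                        ∎

  mono-⊛-> : ∀ {w n} f → n < w → (mono w ⊛ f) n ≡ + 0
  mono-⊛-> {suc w} {zero} f _ = ℤ.*-zeroˡ (f 0)
  mono-⊛-> {suc w} {suc n} f (s≤s n<w) = begin
    (mono (suc w) ⊛ f) (suc n)       ≡⟨ ⊛-suc (mono (suc w)) f n ⟩
    + 0 * f (suc n) + (mono w ⊛ f) n ≡⟨ cong₂ _+_ (ℤ.*-zeroˡ (f (suc n))) (mono-⊛-> f n<w) ⟩
    + 0                              ∎

  one-⊛ : ∀ f → one ⊛ f ≈ f
  one-⊛ f n = mono-⊛-≤ f z≤n

  ⊛-one : ∀ f → f ⊛ one ≈ f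
  ⊛-one f n = trans (⊛-comm f one n) (one-⊛ f n)

  one⊖mono-⊛ : ∀ w f → (one ⊖ mono w) ⊛ f ≈ f ⊖ mono w ⊛ f
  one⊖mono-⊛ w f n = trans (⊛-distribʳ-⊖ one (mono w) f n) (cong (_- (mono w ⊛ f) n) (one-⊛ f n))

  ⊛-swapʳ : ∀ f g h → (f ⊛ g) ⊛ h ≈ (f ⊛ h) ⊛ g
  ⊛-swapʳ f g h n = begin
    ((f ⊛ g) ⊛ h) n  ≡⟨ ⊛-assoc f g h n ⟩
    (f ⊛ (g ⊛ h)) n  ≡⟨ ⊛-congʳ f (⊛-comm g h) n ⟩
    (f ⊛ (h ⊛ g)) n  ≡⟨ sym (⊛-assoc f h g n) ⟩
    ((f ⊛ h) ⊛ g) n  ∎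

  ⊛-interchange : ∀ f g h k → ((f ⊛ g) ⊛ h) ⊛ k ≈ (f ⊛ h) ⊛ (g ⊛ k)
  ⊛-interchange f g h k n = trans (⊛-congˡ k (⊛-swapʳ f g h) n) (⊛-assoc (f ⊛ h) g k n)

  ⊛-one⊖mono-below : ∀ {w i} f → i < w → (f ⊛ (one ⊖ mono w)) i ≡ f i
  ⊛-one⊖mono-below {w} {i} f i<w = begin
    (f ⊛ (one ⊖ mono w)) i  ≡⟨ ⊛-comm f (one ⊖ mono w) i ⟩
    ((one ⊖ mono w) ⊛ f) i  ≡⟨ one⊖mono-⊛ w f i ⟩
    f i - (mono w ⊛ f) i    ≡⟨ cong (λ x → f i - x) (mono-⊛-> f i<w) ⟩
    f i - + 0               ≡⟨ ℤ.+-identityʳ (f i) ⟩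
    f i                     ∎

  invUpTo-stable : ∀ f {n i} → i ≤ n → invUpTo f n i ≡ inv1 f i
  invUpTo-stable f {zero} z≤n = refl
  invUpTo-stable f {suc n} {i} i≤1+n with ℕ.m≤n⇒m<n∨m≡n i≤1+n
  ... | inj₂ refl = refl
  ... | inj₁ (s≤s i≤n) with i ≤ᵇ n | ℕ.≤⇒≤ᵇ i≤n
  ...   | true | _ = invUpTo-stable f i≤n

  inv1-suc : ∀ f n → inv1 f (suc n) ≡ - sumTo n (λ j → f (suc j) * inv1 f (n ∸ j))
  inv1-suc f n with suc n ≤ᵇ n in eq
  ... | true  = contradiction (ℕ.≤ᵇ⇒≤ (suc n) n (subst T (sym eq) _)) ℕ.1+n≰n
  ... | false = cong -_ (sumTo-cong n (λ j _ → cong (f (suc j) *_) (invUpTo-stable f (ℕ.m∸n≤m n j))))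

  ≈[]-extend : ∀ {f g N} → f ≈[ N ] g → f (suc N) ≡ g (suc N) → f ≈[ suc N ] g
  ≈[]-extend f≈g top i i≤1+N with ℕ.m≤n⇒m<n∨m≡n i≤1+N
  ... | inj₁ (s≤s i≤N) = f≈g i i≤N
  ... | inj₂ refl      = top

  ≈[]-pred : ∀ {f g N} → f ≈[ suc N ] g → f ≈[ N ] g
  ≈[]-pred f≈g i i≤N = f≈g i (ℕ.m≤n⇒m≤1+n i≤N)

  inv1-extend : ∀ {f g} N → f 0 ≡ + 1 → (f ⊛ g) (suc N) ≡ + 0 → inv1 f ≈[ N ] g →
                inv1 f (suc N) ≡ g (suc N)
  inv1-extend {f} {g} N f₀≡1 fg₁₊N≡0 inv1≈g = begin
    inv1 f (suc N)                                ≡⟨ inv1-suc f N ⟩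
    - sumTo N (λ j → f (suc j) * inv1 f (N ∸ j))  ≡⟨ cong -_ (sumTo-cong N (λ j _ →
                                                       cong (f (suc j) *_) (inv1≈g (N ∸ j) (ℕ.m∸n≤m N j)))) ⟩
    - (shift f ⊛ g) N                             ≡⟨ sym (inverseˡ-unique _ _ g₁₊N+rest≡0) ⟩
    g (suc N)                                     ∎
    where
    g₁₊N+rest≡0 : g (suc N) + (shift f ⊛ g) N ≡ + 0
    g₁₊N+rest≡0 = begin
      g (suc N) + (shift f ⊛ g) N        ≡⟨ cong (λ x → x + (shift f ⊛ g) N) (sym (ℤ.*-identityˡ (g (suc N)))) ⟩
      + 1 * g (suc N) + (shift f ⊛ g) N  ≡⟨ cong (λ x → x * g (suc N) + (shift f ⊛ g) N) (sym f₀≡1) ⟩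
      f 0 * g (suc N) + (shift f ⊛ g) N  ≡⟨ sym (⊛-suc f g N) ⟩
      (f ⊛ g) (suc N)                    ≡⟨ fg₁₊N≡0 ⟩
      + 0                                ∎

  inv1-unique : ∀ {f g} N → f 0 ≡ + 1 → f ⊛ g ≈[ N ] one → inv1 f ≈[ N ] g
  inv1-unique {f} {g} zero f₀≡1 fg≈1 .zero z≤n = begin
    + 1        ≡⟨ sym (fg≈1 0 z≤n) ⟩
    f 0 * g 0  ≡⟨ cong (_* g 0) f₀≡1 ⟩
    + 1 * g 0  ≡⟨ ℤ.*-identityˡ (g 0) ⟩
    g 0        ∎
  inv1-unique (suc N) f₀≡1 fg≈1 =
    ≈[]-extend inv1≈g (inv1-extend N f₀≡1 (fg≈1 (suc N) ℕ.≤-refl) inv1≈g)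
    where inv1≈g = inv1-unique N f₀≡1 (≈[]-pred fg≈1)

  one-pos : ∀ {i} → 0 < i → one i ≡ + 0
  one-pos (s≤s _) = refl

  geometric : (m : ℕ) .{{_ : NonZero m}} → Series
  geometric m n = one (n % m)

  inv1-geometric : ∀ m .{{_ : NonZero m}} → inv1 (one ⊖ mono m) ≈ geometric m
  inv1-geometric m n = inv1-unique {g = geometric m} n (one⊖mono-0 m) factor⊛geometric n ℕ.≤-refl
    where
    one⊖mono-0 : ∀ m .{{_ : NonZero m}} → (one ⊖ mono m) 0 ≡ + 1
    one⊖mono-0 (suc m) = refl
    factor⊛geometric : (one ⊖ mono m) ⊛ geometric m ≈[ n ] one
    factor⊛geometric i _ with m ≤? i
    ... | yes m≤i = begin
      ((one ⊖ mono m) ⊛ geometric m) i        ≡⟨ one⊖mono-⊛ m (geometric m) i ⟩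
      one (i % m) - (mono m ⊛ geometric m) i  ≡⟨ cong (λ x → one (i % m) - x) (mono-⊛-≤ (geometric m) m≤i) ⟩
      one (i % m) - one ((i ∸ m) % m)         ≡⟨ cong (λ j → one (i % m) - one j) (m≤n⇒[n∸m]%m≡n%m m≤i) ⟩
      one (i % m) - one (i % m)               ≡⟨ ℤ.+-inverseʳ (one (i % m)) ⟩
      + 0                                     ≡⟨ sym (one-pos (ℕ.<-≤-trans (ℕ.>-nonZero⁻¹ m) m≤i)) ⟩
      one i                                   ∎
    ... | no m≰i = begin
      ((one ⊖ mono m) ⊛ geometric m) i        ≡⟨ one⊖mono-⊛ m (geometric m) i ⟩
      one (i % m) - (mono m ⊛ geometric m) i  ≡⟨ cong (λ x → one (i % m) - x) (mono-⊛-> (geometric m) i<m) ⟩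
      one (i % m) - + 0                       ≡⟨ ℤ.+-identityʳ (one (i % m)) ⟩
      one (i % m)                             ≡⟨ cong one (m<n⇒m%n≡m i<m) ⟩
      one i                                   ∎
      where i<m = ℕ.≰⇒> m≰i

open PowerSeries

module Counting where

  open import Data.Nat using (_+_; _*_)

  Finite : Set → Set
  Finite A = Σ ℕ λ k → Fin k ↔ A

  finite-↔ : ∀ {A B} → Finite A → A ↔ B → Finite B
  finite-↔ (k , f) g = k , ↔-trans f g

  finite-⊎ : ∀ {A B} → Finite A → Finite B → Finite (A ⊎ B)
  finite-⊎ (k , f) (l , g) = k + l , ↔-trans +↔⊎ (f ⊎-↔ g)

  finite-empty : ∀ {A} → ¬ A → Finite A
  finite-empty ¬a = 0 , mk↔ₛ′ (λ ()) (λ a → contradiction a ¬a) (λ a → contradiction a ¬a) (λ ())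

  finite-singleton : ∀ {A} (a : A) → (∀ b → b ≡ a) → Finite A
  finite-singleton a unique =
    1 , mk↔ₛ′ (λ _ → a) (λ _ → Fin.zero) (λ b → sym (unique b)) (λ { Fin.zero → refl ; (Fin.suc ()) })

  card-unique : ∀ {A : Set} {m n} → Fin m ↔ A → Fin n ↔ A → m ≡ n
  card-unique f g = ↔⇒≡ (↔-trans f (↔-sym g))

  code : ColPart → ℕ
  code (zero  , false) = 0
  code (zero  , true)  = 1
  code (suc s , c)     = suc (suc (code (s , c)))

  decode : ℕ → ColPart
  decode 0             = 0 , false
  decode 1             = 0 , true
  decode (suc (suc c)) = map₁ suc (decode c)

  decode-code : ∀ p → decode (code p) ≡ p
  decode-code (zero  , false) = refl
  decode-code (zero  , true)  = refl
  decode-code (suc s , c)     = cong (map₁ suc) (decode-code (s , c))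

  code-decode : ∀ c → code (decode c) ≡ c
  code-decode 0             = refl
  code-decode 1             = refl
  code-decode (suc (suc c)) = cong (suc ∘ suc) (code-decode c)

  decode-even : ∀ s → decode (s * 2) ≡ (s , false)
  decode-even zero    = refl
  decode-even (suc s) = cong (map₁ suc) (decode-even s)

  decode-odd : ∀ s → decode (suc (s * 2)) ≡ (s , true)
  decode-odd zero    = refl
  decode-odd (suc s) = cong (map₁ suc) (decode-odd s)

  code-true : ∀ s → code (s , true) ≡ suc (code (s , false))
  code-true zero    = refl
  code-true (suc s) = cong (suc ∘ suc) (code-true s)

  code-lower : ∀ p → proj₁ p * 2 ≤ code p
  code-lower (zero  , _) = z≤n
  code-lower (suc s , c) = s≤s (s≤s (code-lower (s , c)))

  code-upper : ∀ p → code p ≤ suc (proj₁ p * 2)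
  code-upper (zero  , false) = z≤n
  code-upper (zero  , true)  = s≤s z≤n
  code-upper (suc s , c)     = s≤s (s≤s (code-upper (s , c)))

  ≤Pᵇ⇒code≤ : ∀ p q → T (p ≤Pᵇ q) → code p ≤ code q
  ≤Pᵇ⇒code≤ (zero  , false) (zero  , _)    _ = z≤n
  ≤Pᵇ⇒code≤ (zero  , true)  (zero  , true) _ = s≤s z≤n
  ≤Pᵇ⇒code≤ (zero  , false) (suc s , _)    _ = z≤n
  ≤Pᵇ⇒code≤ (zero  , true)  (suc s , _)    _ = s≤s z≤n
  ≤Pᵇ⇒code≤ (suc t , d)     (suc s , c)    p≤q = s≤s (s≤s (≤Pᵇ⇒code≤ (t , d) (s , c) p≤q))

  code≤⇒≤Pᵇ : ∀ p q → code p ≤ code q → T (p ≤Pᵇ q)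
  code≤⇒≤Pᵇ (zero  , false) (zero  , _)    _ = tt
  code≤⇒≤Pᵇ (zero  , true)  (zero  , true) _ = tt
  code≤⇒≤Pᵇ (zero  , true)  (zero  , false) ()
  code≤⇒≤Pᵇ (zero  , _)     (suc s , _)    _ = tt
  code≤⇒≤Pᵇ (suc t , d)     (zero  , false) ()
  code≤⇒≤Pᵇ (suc t , d)     (zero  , true) (s≤s ())
  code≤⇒≤Pᵇ (suc t , d)     (suc s , c)    (s≤s (s≤s p≤q)) = code≤⇒≤Pᵇ (t , d) (s , c) p≤q

  partWeight : ColPart → ℕ
  partWeight p = proj₁ p * 2

  weight : ℕ → ℕ
  weight c = partWeight (decode c)

  Fits : ℕ → ℕ → Set
  Fits c n = T (validPart (decode c)) × weight c ≤ n

  fits? : ∀ c n → Dec (Fits c n)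
  fits? c n = T? (validPart (decode c)) ×-dec (weight c ≤? n)

  fits⇒weight>0 : ∀ c {n} → Fits c n → 0 < weight c
  fits⇒weight>0 c fits with decode c | fits
  ... | suc s , _ | _ = s≤s z≤n

  code≤1+weight : ∀ c → c ≤ suc (weight c)
  code≤1+weight c = subst (_≤ suc (weight c)) (code-decode c) (code-upper (decode c))

  DescendingFrom : ℕ → List ColPart → Set
  DescendingFrom c []       = ⊤
  DescendingFrom c (p ∷ ps) = T (validPart p) × code p ≤ c × DescendingFrom (code p) ps

  DescendingFrom-irrelevant : ∀ c ps (d d′ : DescendingFrom c ps) → d ≡ d′
  DescendingFrom-irrelevant c []       _             _                = refl
  DescendingFrom-irrelevant c (p ∷ ps) (v , p≤c , d) (v′ , p≤c′ , d′) =
    cong₂ _,_ (T-irrelevant v v′)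
              (cong₂ _,_ (ℕ.≤-irrelevant p≤c p≤c′) (DescendingFrom-irrelevant (code p) ps d d′))

  DescendingFrom-weaken : ∀ {c c′} ps → c ≤ c′ → DescendingFrom c ps → DescendingFrom c′ ps
  DescendingFrom-weaken []       c≤c′ _             = tt
  DescendingFrom-weaken (p ∷ ps) c≤c′ (v , p≤c , d) = v , ℕ.≤-trans p≤c c≤c′ , d

  descending⇒allValid : ∀ {c} ps → DescendingFrom c ps → T (allValid ps)
  descending⇒allValid []       _         = tt
  descending⇒allValid (p ∷ ps) (v , _ , d) = Equivalence.from T-∧ (v , descending⇒allValid ps d)

  descending⇒nonIncr : ∀ {c} ps → DescendingFrom c ps → T (nonIncr ps)
  descending⇒nonIncr []           _                       = tt
  descending⇒nonIncr (p ∷ [])     _                       = tt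
  descending⇒nonIncr (p ∷ q ∷ qs) (_ , _ , d@(_ , q≤p , _)) =
    Equivalence.from T-∧ (code≤⇒≤Pᵇ q p q≤p , descending⇒nonIncr (q ∷ qs) d)

  descending⇒bounded : ∀ {c} ps → DescendingFrom c ps → All (λ p → code p ≤ c) ps
  descending⇒bounded []       _             = []
  descending⇒bounded (p ∷ ps) (_ , p≤c , d) =
    p≤c ∷ All.map (λ q≤p → ℕ.≤-trans q≤p p≤c) (descending⇒bounded ps d)

  cubic⇒descending : ∀ {c} p ps → T (allValid (p ∷ ps)) → T (nonIncr (p ∷ ps)) → code p ≤ c →
                     DescendingFrom c (p ∷ ps)
  cubic⇒descending p []       valid _ p≤c = proj₁ (Equivalence.to T-∧ valid) , p≤c , tt
  cubic⇒descending p (q ∷ qs) valid sorted p≤c =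
    proj₁ valid′ , p≤c ,
    cubic⇒descending q qs (proj₂ valid′) (proj₂ sorted′) (≤Pᵇ⇒code≤ q p (proj₁ sorted′))
    where
    valid′  = Equivalence.to T-∧ valid
    sorted′ = Equivalence.to T-∧ sorted

  *2-split : ∀ s t {n} → (s + t) * 2 ≡ n → s * 2 ≤ n × t * 2 ≡ n ∸ s * 2
  *2-split s t refl rewrite ℕ.*-distribʳ-+ 2 s t = ℕ.m≤m+n (s * 2) (t * 2) , sym (ℕ.m+n∸m≡n (s * 2) (t * 2))

  *2-join : ∀ s t {n} → s * 2 ≤ n → t * 2 ≡ n ∸ s * 2 → (s + t) * 2 ≡ n
  *2-join s t s≤n t≡ =
    trans (ℕ.*-distribʳ-+ 2 s t) (trans (cong (λ x → s * 2 + x) t≡) (ℕ.m+[n∸m]≡n s≤n))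

  -- The index n is twice the size of the partition, matching the q² of (q²;q²)_∞.
  CubicUpTo : ℕ → ℕ → Set
  CubicUpTo β n = Σ (List ColPart) λ ps → DescendingFrom β ps × sizeSum ps * 2 ≡ n

  CubicUpTo-≡ : ∀ {β n} {x y : CubicUpTo β n} → proj₁ x ≡ proj₁ y → x ≡ y
  CubicUpTo-≡ {β} {x = ps , d , e} {y = .ps , d′ , e′} refl =
    cong₂ (λ d e → ps , d , e) (DescendingFrom-irrelevant β ps d d′) (ℕ.≡-irrelevant e e′)

  module _ {β n : ℕ} where

    private
      top = decode (suc β)
      W   = weight (suc β)

    include : CubicUpTo β n → CubicUpTo (suc β) n
    include (ps , d , e) = ps , DescendingFrom-weaken ps (ℕ.n≤1+n β) d , e

    prepend : Fits (suc β) n → CubicUpTo (suc β) (n ∸ W) → CubicUpTo (suc β) n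
    prepend (valid , W≤n) (ps , d , e) =
      top ∷ ps ,
      (valid , ℕ.≤-reflexive (code-decode (suc β)) ,
       subst (λ c → DescendingFrom c ps) (sym (code-decode (suc β))) d) ,
      *2-join (proj₁ top) (sizeSum ps) W≤n e

    include≢prepend : ∀ {f} x y → include x ≢ prepend f y
    include≢prepend (p ∷ _ , (_ , p≤β , _) , _) _ eq =
      ℕ.1+n≰n (subst (_≤ β) (trans (cong code p≡top) (code-decode (suc β))) p≤β)
      where p≡top = List.∷-injectiveˡ (cong proj₁ eq)

    split : (x : CubicUpTo (suc β) n) →
            (∃ λ y → include y ≡ x) ⊎ (Σ (Fits (suc β) n) λ f → ∃ λ y → prepend f y ≡ x)
    split ([] , _ , e) = inj₁ (([] , tt , e) , refl)
    split (p ∷ ps , (v , p≤1+β , d) , e) with code p ≤? β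
    ... | yes p≤β = inj₁ ((p ∷ ps , (v , p≤β , d) , e) , CubicUpTo-≡ refl)
    ... | no  p≰β = inj₂ ((subst (T ∘ validPart) (sym top≡p) v , W≤n) ,
                          (ps , subst (λ c → DescendingFrom c ps) code≡ d , tail≡) ,
                          CubicUpTo-≡ (cong (_∷ ps) top≡p))
      where
      code≡ : code p ≡ suc β
      code≡ = ℕ.≤-antisym p≤1+β (ℕ.≰⇒> p≰β)
      top≡p : top ≡ p
      top≡p = trans (cong decode (sym code≡)) (decode-code p)
      W≡ : W ≡ proj₁ p * 2
      W≡ = cong (λ q → proj₁ q * 2) top≡p
      W≤n : W ≤ n
      W≤n = subst (_≤ n) (sym W≡) (proj₁ (*2-split (proj₁ p) (sizeSum ps) e))
      tail≡ : sizeSum ps * 2 ≡ n ∸ W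
      tail≡ = trans (proj₂ (*2-split (proj₁ p) (sizeSum ps) e)) (cong (n ∸_) (sym W≡))

    cubicUpTo-fits : Fits (suc β) n → (CubicUpTo β n ⊎ CubicUpTo (suc β) (n ∸ W)) ↔ CubicUpTo (suc β) n
    cubicUpTo-fits f = ⤖⇒↔ (mk⤖ (injective , strictlySurjective⇒surjective surjective))
      where
      to = [ include , prepend f ]
      injective : Injective _≡_ _≡_ to
      injective {inj₁ x} {inj₁ y} eq = cong inj₁ (CubicUpTo-≡ (cong proj₁ eq))
      injective {inj₂ x} {inj₂ y} eq = cong inj₂ (CubicUpTo-≡ (List.∷-injectiveʳ (cong proj₁ eq)))
      injective {inj₁ x} {inj₂ y} eq = contradiction eq (include≢prepend {f} x y)
      injective {inj₂ x} {inj₁ y} eq = contradiction (sym eq) (include≢prepend {f} y x)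
      surjective : ∀ x → ∃ λ y → to y ≡ x
      surjective x with split x
      ... | inj₁ (y , eq)      = inj₁ y , eq
      ... | inj₂ (_ , y , eq) = inj₂ y , trans (CubicUpTo-≡ refl) eq

    cubicUpTo-¬fits : ¬ Fits (suc β) n → CubicUpTo β n ↔ CubicUpTo (suc β) n
    cubicUpTo-¬fits ¬f = ⤖⇒↔ (mk⤖ (injective , strictlySurjective⇒surjective surjective))
      where
      injective : Injective _≡_ _≡_ include
      injective eq = CubicUpTo-≡ (cong proj₁ eq)
      surjective : ∀ x → ∃ λ y → include y ≡ x
      surjective x with split x
      ... | inj₁ y-eq       = y-eq
      ... | inj₂ (f , _) = contradiction f ¬f

  cubicUpTo0-[] : ∀ {n} (x : CubicUpTo 0 n) → proj₁ x ≡ []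
  cubicUpTo0-[] ([] , _) = refl
  cubicUpTo0-[] ((zero , false) ∷ _ , (() , _) , _)
  cubicUpTo0-[] ((zero , true)  ∷ _ , (_ , () , _) , _)
  cubicUpTo0-[] ((suc _ , _)    ∷ _ , (_ , () , _) , _)

  finiteCubicUpTo : ∀ β n → Finite (CubicUpTo β n)
  finiteCubicUpTo zero    zero    = finite-singleton ([] , tt , refl) (λ x → CubicUpTo-≡ (cubicUpTo0-[] x))
  finiteCubicUpTo zero    (suc n) = finite-empty λ x →
    ℕ.0≢1+n (subst (λ ps → sizeSum ps * 2 ≡ suc n) (cubicUpTo0-[] x) (proj₂ (proj₂ x)))
  finiteCubicUpTo (suc β) = <-rec (Finite ∘ CubicUpTo (suc β)) step
    where
    step : ∀ n → (∀ {m} → m < n → Finite (CubicUpTo (suc β) m)) → Finite (CubicUpTo (suc β) n)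
    step n smaller with fits? (suc β) n
    ... | yes f = finite-↔ (finite-⊎ (finiteCubicUpTo β n) (smaller n∸W<n)) (cubicUpTo-fits f)
      where n∸W<n = ℕ.∸-monoʳ-< (fits⇒weight>0 (suc β) f) (proj₂ f)
    ... | no ¬f = finite-↔ (finiteCubicUpTo β n) (cubicUpTo-¬fits ¬f)

  cubicCount : ℕ → ℕ → ℕ
  cubicCount β n = proj₁ (finiteCubicUpTo β n)

  cubicCount-fits : ∀ β {n} → Fits (suc β) n →
                    cubicCount (suc β) n ≡ cubicCount β n + cubicCount (suc β) (n ∸ weight (suc β))
  cubicCount-fits β {n} f = card-unique (proj₂ (finiteCubicUpTo (suc β) n))
    (proj₂ (finite-↔ (finite-⊎ (finiteCubicUpTo β n) (finiteCubicUpTo (suc β) _)) (cubicUpTo-fits {β} f)))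

  cubicCount-¬fits : ∀ β {n} → ¬ Fits (suc β) n → cubicCount (suc β) n ≡ cubicCount β n
  cubicCount-¬fits β {n} ¬f = card-unique (proj₂ (finiteCubicUpTo (suc β) n))
    (proj₂ (finite-↔ (finiteCubicUpTo β n) (cubicUpTo-¬fits {β} ¬f)))

  cubicCount-at-0 : ∀ β → cubicCount β 0 ≡ 1
  cubicCount-at-0 zero    = refl
  cubicCount-at-0 (suc β) =
    trans (cubicCount-¬fits β λ f → ℕ.<⇒≱ (fits⇒weight>0 (suc β) f) (proj₂ f)) (cubicCount-at-0 β)

  cubicCount-odd : ∀ β m → cubicCount β (suc (m * 2)) ≡ 0
  cubicCount-odd β m = card-unique (proj₂ (finiteCubicUpTo β _)) (proj₂ (finite-empty odd-weight))
    where
    odd-weight : ¬ CubicUpTo β (suc (m * 2))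
    odd-weight (ps , _ , e) =
      ℕ.even≢odd (sizeSum ps) m (trans (ℕ.*-comm 2 (sizeSum ps)) (trans e (cong suc (ℕ.*-comm m 2))))

  cubicCount-stable : ∀ {β n} → n < β → cubicCount β n ≡ cubicCount (suc n) n
  cubicCount-stable {suc β} {n} n<1+β with ℕ.m≤n⇒m<n∨m≡n n<1+β
  ... | inj₂ refl      = refl
  ... | inj₁ (s≤s n<β) =
    trans (cubicCount-¬fits β λ f → ℕ.<⇒≱ (ℕ.<-≤-trans n<β β≤W) (proj₂ f)) (cubicCount-stable n<β)
    where
    β≤W : β ≤ weight (suc β)
    β≤W = ℕ.≤-pred (code≤1+weight (suc β))

  validCount : ColPart → ℕ
  validCount p = if validPart p then 1 else 0

  cubicCount-top : ∀ β {n} → weight (suc β) ≡ n →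
                   cubicCount (suc β) n ≡ cubicCount β n + validCount (decode (suc β))
  cubicCount-top β {n} W≡n = by-validity _ refl
    where
    open ≡-Reasoning
    by-validity : ∀ b → validPart (decode (suc β)) ≡ b →
                  cubicCount (suc β) n ≡ cubicCount β n + (if b then 1 else 0)
    by-validity false invalid =
      trans (cubicCount-¬fits β λ f → subst T invalid (proj₁ f)) (sym (ℕ.+-identityʳ _))
    by-validity true  valid   = begin
      cubicCount (suc β) n
        ≡⟨ cubicCount-fits β (subst T (sym valid) tt , ℕ.≤-reflexive W≡n) ⟩
      cubicCount β n + cubicCount (suc β) (n ∸ weight (suc β))
        ≡⟨ cong (λ m → cubicCount β n + cubicCount (suc β) m) (trans (cong (n ∸_) W≡n) (ℕ.n∸n≡0 n)) ⟩
      cubicCount β n + cubicCount (suc β) 0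
        ≡⟨ cong (λ x → cubicCount β n + x) (cubicCount-at-0 (suc β)) ⟩
      cubicCount β n + 1 ∎

open Counting
open import Data.Integer using (_+_; _-_; _*_)
open ≡-Reasoning

m+n-n≡m : ∀ m n → m + n - n ≡ m
m+n-n≡m = solve-∀

cubicSeries : ℕ → Series
cubicSeries β n = + cubicCount β n

partFactor : ColPart → Series
partFactor p = if validPart p then one ⊖ mono (partWeight p) else one

denominator : ℕ → Series
denominator = prodFrom1 (partFactor ∘ decode)

factor⊛cubicSeries : ∀ β → partFactor (decode (suc β)) ⊛ cubicSeries (suc β) ≈ cubicSeries β
factor⊛cubicSeries β n = by-validity _ refl
  where
  W = weight (suc β)
  by-validity : ∀ b → validPart (decode (suc β)) ≡ b →
                ((if b then one ⊖ mono W else one) ⊛ cubicSeries (suc β)) n ≡ cubicSeries β n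
  by-validity false invalid = trans (one-⊛ (cubicSeries (suc β)) n)
                                    (cong +_ (cubicCount-¬fits β λ f → subst T invalid (proj₁ f)))
  by-validity true  valid   with W ≤? n
  ... | yes W≤n = begin
    ((one ⊖ mono W) ⊛ cubicSeries (suc β)) n
      ≡⟨ one⊖mono-⊛ W (cubicSeries (suc β)) n ⟩
    + cubicCount (suc β) n - (mono W ⊛ cubicSeries (suc β)) n
      ≡⟨ cong (λ x → + cubicCount (suc β) n - x) (mono-⊛-≤ (cubicSeries (suc β)) W≤n) ⟩
    + cubicCount (suc β) n - + cubicCount (suc β) (n ∸ W)
      ≡⟨ cong (λ k → + k - + cubicCount (suc β) (n ∸ W)) (cubicCount-fits β (subst T (sym valid) tt , W≤n)) ⟩
    + (cubicCount β n ℕ.+ cubicCount (suc β) (n ∸ W)) - + cubicCount (suc β) (n ∸ W)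
      ≡⟨ cong (_- + cubicCount (suc β) (n ∸ W)) (ℤ.pos-+ (cubicCount β n) (cubicCount (suc β) (n ∸ W))) ⟩
    + cubicCount β n + + cubicCount (suc β) (n ∸ W) - + cubicCount (suc β) (n ∸ W)
      ≡⟨ m+n-n≡m (+ cubicCount β n) (+ cubicCount (suc β) (n ∸ W)) ⟩
    + cubicCount β n ∎
  ... | no  W≰n = begin
    ((one ⊖ mono W) ⊛ cubicSeries (suc β)) n
      ≡⟨ one⊖mono-⊛ W (cubicSeries (suc β)) n ⟩
    + cubicCount (suc β) n - (mono W ⊛ cubicSeries (suc β)) n
      ≡⟨ cong (λ x → + cubicCount (suc β) n - x) (mono-⊛-> (cubicSeries (suc β)) (ℕ.≰⇒> W≰n)) ⟩
    + cubicCount (suc β) n - + 0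
      ≡⟨ ℤ.+-identityʳ (+ cubicCount (suc β) n) ⟩
    + cubicCount (suc β) n
      ≡⟨ cong +_ (cubicCount-¬fits β λ f → W≰n (proj₂ f)) ⟩
    + cubicCount β n ∎

cubicSeries-0 : cubicSeries 0 ≈ one
cubicSeries-0 zero    = refl
cubicSeries-0 (suc n) = refl

denominator⊛cubicSeries : ∀ β → denominator β ⊛ cubicSeries β ≈ one
denominator⊛cubicSeries zero    n = trans (one-⊛ (cubicSeries 0) n) (cubicSeries-0 n)
denominator⊛cubicSeries (suc β) n = begin
  ((denominator β ⊛ F) ⊛ cubicSeries (suc β)) n  ≡⟨ ⊛-assoc (denominator β) F (cubicSeries (suc β)) n ⟩
  (denominator β ⊛ (F ⊛ cubicSeries (suc β))) n  ≡⟨ ⊛-congʳ (denominator β) (factor⊛cubicSeries β) n ⟩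
  (denominator β ⊛ cubicSeries β) n              ≡⟨ denominator⊛cubicSeries β n ⟩
  one n                                          ∎
  where F = partFactor (decode (suc β))

poch : ℕ → ℕ → Series
poch m = prodFrom1 (λ k → one ⊖ mono (m ℕ.* k))

poch-truncate : ∀ m .{{_ : NonZero m}} {N i} → i ≤ N → poch m N i ≡ qPoch m i
poch-truncate m {zero}  z≤n = refl
poch-truncate m {suc N} {i} i≤1+N with ℕ.m≤n⇒m<n∨m≡n i≤1+N
... | inj₂ refl      = refl
... | inj₁ (s≤s i≤N) = trans (⊛-one⊖mono-below (poch m N) i<m*[1+N]) (poch-truncate m i≤N)
  where i<m*[1+N] = ℕ.<-≤-trans (s≤s i≤N) (ℕ.m≤n*m (suc N) m)

isOdd-even : ∀ j → isOdd (j ℕ.* 2) ≡ false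
isOdd-even zero    = refl
isOdd-even (suc j) = isOdd-even j

isOdd-odd : ∀ j → isOdd (suc (j ℕ.* 2)) ≡ true
isOdd-odd zero    = refl
isOdd-odd (suc j) = isOdd-odd j

partFactor-uncoloured : ∀ s → partFactor (suc s , false) ≡ one ⊖ mono (suc s ℕ.* 2)
partFactor-uncoloured s = cong (if_then one ⊖ mono (suc s ℕ.* 2) else one) (∨-zeroʳ (not (isOdd (suc s))))

partFactor-coloured-odd : ∀ j → partFactor (suc (j ℕ.* 2) , true) ≡ one
partFactor-coloured-odd j =
  cong (λ b → if not b ∨ false then one ⊖ mono (suc (j ℕ.* 2) ℕ.* 2) else one) (isOdd-odd j)

partFactor-coloured-even : ∀ j → partFactor (suc j ℕ.* 2 , true) ≡ one ⊖ mono (suc j ℕ.* 2 ℕ.* 2)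
partFactor-coloured-even j =
  cong (λ b → if not b ∨ false then one ⊖ mono (suc j ℕ.* 2 ℕ.* 2) else one) (isOdd-even j)

denominator-suc-size : ∀ s → denominator (code (suc s , true)) ≈
                       (denominator (code (s , true)) ⊛ partFactor (suc s , false)) ⊛ partFactor (suc s , true)
denominator-suc-size s n =
  cong₂ (λ p q → ((denominator (code (s , true)) ⊛ partFactor p) ⊛ partFactor q) n)
        (trans (cong (decode ∘ suc) (code-true s)) (decode-code (suc s , false)))
        (decode-code (suc s , true))

denominator-even : ∀ j → denominator (code (j ℕ.* 2 , true)) ≈ poch 2 (j ℕ.* 2) ⊛ poch 4 j
denominator-odd  : ∀ j → denominator (code (suc (j ℕ.* 2) , true)) ≈ poch 2 (suc (j ℕ.* 2)) ⊛ poch 4 j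

denominator-even zero    n = refl
denominator-even (suc j) n = begin
  denominator (code (s , true)) n
    ≡⟨ denominator-suc-size (suc (j ℕ.* 2)) n ⟩
  ((denominator (code (suc (j ℕ.* 2) , true)) ⊛ partFactor (s , false)) ⊛ partFactor (s , true)) n
    ≡⟨ cong₂ (λ F G → ((denominator (code (suc (j ℕ.* 2) , true)) ⊛ F) ⊛ G) n)
             (partFactor-uncoloured (suc (j ℕ.* 2))) (partFactor-coloured-even j) ⟩
  ((denominator (code (suc (j ℕ.* 2) , true)) ⊛ (one ⊖ mono w)) ⊛ (one ⊖ mono w)) n
    ≡⟨ ⊛-congˡ (one ⊖ mono w) (⊛-congˡ (one ⊖ mono w) (denominator-odd j)) n ⟩
  (((poch 2 (suc (j ℕ.* 2)) ⊛ poch 4 j) ⊛ (one ⊖ mono w)) ⊛ (one ⊖ mono w)) n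
    ≡⟨ ⊛-interchange (poch 2 (suc (j ℕ.* 2))) (poch 4 j) (one ⊖ mono w) (one ⊖ mono w) n ⟩
  ((poch 2 (suc (j ℕ.* 2)) ⊛ (one ⊖ mono w)) ⊛ (poch 4 j ⊛ (one ⊖ mono w))) n
    ≡⟨ cong₂ (λ a b → ((poch 2 (suc (j ℕ.* 2)) ⊛ (one ⊖ mono a)) ⊛ (poch 4 j ⊛ (one ⊖ mono b))) n)
             (ℕ.*-comm s 2) (weight≡ j) ⟩
  (poch 2 s ⊛ poch 4 (suc j)) n ∎
  where
  s = suc j ℕ.* 2
  w = s ℕ.* 2
  weight≡ : ∀ j → suc j ℕ.* 2 ℕ.* 2 ≡ 4 ℕ.* suc j
  weight≡ = ℕ-Solver.solve-∀
denominator-odd j n = begin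
  denominator (code (suc (j ℕ.* 2) , true)) n
    ≡⟨ denominator-suc-size (j ℕ.* 2) n ⟩
  ((denominator (code (j ℕ.* 2 , true)) ⊛ partFactor (suc (j ℕ.* 2) , false)) ⊛ partFactor (suc (j ℕ.* 2) , true)) n
    ≡⟨ cong₂ (λ F G → ((denominator (code (j ℕ.* 2 , true)) ⊛ F) ⊛ G) n)
             (partFactor-uncoloured (j ℕ.* 2)) (partFactor-coloured-odd j) ⟩
  ((denominator (code (j ℕ.* 2 , true)) ⊛ (one ⊖ mono w)) ⊛ one) n
    ≡⟨ ⊛-one (denominator (code (j ℕ.* 2 , true)) ⊛ (one ⊖ mono w)) n ⟩
  (denominator (code (j ℕ.* 2 , true)) ⊛ (one ⊖ mono w)) n
    ≡⟨ ⊛-congˡ (one ⊖ mono w) (denominator-even j) n ⟩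
  ((poch 2 (j ℕ.* 2) ⊛ poch 4 j) ⊛ (one ⊖ mono w)) n
    ≡⟨ ⊛-swapʳ (poch 2 (j ℕ.* 2)) (poch 4 j) (one ⊖ mono w) n ⟩
  ((poch 2 (j ℕ.* 2) ⊛ (one ⊖ mono w)) ⊛ poch 4 j) n
    ≡⟨ cong (λ a → ((poch 2 (j ℕ.* 2) ⊛ (one ⊖ mono a)) ⊛ poch 4 j) n) (ℕ.*-comm (suc (j ℕ.* 2)) 2) ⟩
  (poch 2 (suc (j ℕ.* 2)) ⊛ poch 4 j) n ∎
  where
  w = suc (j ℕ.* 2) ℕ.* 2

inv1-qPoch : ∀ n → inv1 (qPoch 2 ⊛ qPoch 4) n ≡ + cubicCount (suc n) n
inv1-qPoch n = begin
  inv1 (qPoch 2 ⊛ qPoch 4) n  ≡⟨ inv1-unique {g = cubicSeries β} n refl agree n ℕ.≤-refl ⟩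
  + cubicCount β n            ≡⟨ cong +_ (cubicCount-stable n<β) ⟩
  + cubicCount (suc n) n      ∎
  where
  β = code (n ℕ.* 2 , true)
  n<β : n < β
  n<β = subst (n <_) (sym (code-true (n ℕ.* 2)))
          (s≤s (ℕ.≤-trans (ℕ.≤-trans (ℕ.m≤m*n n 2) (ℕ.m≤m*n (n ℕ.* 2) 2)) (code-lower (n ℕ.* 2 , false))))
  truncate : ∀ m .{{_ : NonZero m}} {N} → qPoch m ≈[ N ] poch m N
  truncate m i i≤N = sym (poch-truncate m i≤N)
  agree : (qPoch 2 ⊛ qPoch 4) ⊛ cubicSeries β ≈[ n ] one
  agree i i≤n = begin
    ((qPoch 2 ⊛ qPoch 4) ⊛ cubicSeries β) i
      ≡⟨ ⊛-cong-≈[] {g = cubicSeries β} {g′ = cubicSeries β}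
                    (⊛-cong-≈[] (λ k k≤n → truncate 2 k (ℕ.≤-trans k≤n (ℕ.m≤m*n n 2))) (truncate 4))
                    (λ _ _ → refl) i i≤n ⟩
    ((poch 2 (n ℕ.* 2) ⊛ poch 4 n) ⊛ cubicSeries β) i
      ≡⟨ ⊛-congˡ (cubicSeries β) (λ k → sym (denominator-even n k)) i ⟩
    (denominator β ⊛ cubicSeries β) i
      ≡⟨ denominator⊛cubicSeries β i ⟩
    one i ∎

RhoC-≡ : ∀ {n} {r r′ : RhoC n} →
         RhoC.largest r ≡ RhoC.largest r′ → RhoC.rest r ≡ RhoC.rest r′ → r ≡ r′
RhoC-≡ {r = mkRhoC l ps pos (c , s) below total} {mkRhoC .l .ps pos′ (c′ , s′) below′ total′} refl refl
  rewrite ℕ.≤-irrelevant pos pos′ | T-irrelevant c c′ | ℕ.≡-irrelevant s s′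
        | All.irrelevant ℕ.<-irrelevant below below′ | ℕ.≡-irrelevant total total′ = refl

m*2≡m+m : ∀ m → m ℕ.* 2 ≡ m ℕ.+ m
m*2≡m+m = ℕ-Solver.solve-∀

module _ {l n : ℕ} (l*2≡1+n : l ℕ.* 2 ≡ suc n) where

  code≤⇒size< : ∀ p → code p ≤ n → proj₁ p < l
  code≤⇒size< p p≤n = ℕ.*-cancelʳ-< 2 (proj₁ p) l
    (subst (proj₁ p ℕ.* 2 <_) (sym l*2≡1+n) (s≤s (ℕ.≤-trans (code-lower p) p≤n)))

  size<⇒code≤ : ∀ p → proj₁ p < l → code p ≤ n
  size<⇒code≤ p p<l = ℕ.≤-pred (ℕ.≤-trans (s≤s (code-upper p))
    (subst (suc (proj₁ p) ℕ.* 2 ≤_) l*2≡1+n (ℕ.*-monoˡ-≤ 2 p<l)))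

m*2≡1+n⇒1≤m : ∀ {m n} → m ℕ.* 2 ≡ suc n → 1 ≤ m
m*2≡1+n⇒1≤m {suc m} _ = s≤s z≤n

cubicUpTo↔RhoC : ∀ n → CubicUpTo n (suc n) ↔ RhoC (suc n)
cubicUpTo↔RhoC n = mk↔ₛ′ to from (λ r → RhoC-≡ (size≡ r) refl) (λ _ → CubicUpTo-≡ refl)
  where
  to : CubicUpTo n (suc n) → RhoC (suc n)
  to (ps , d , e) = mkRhoC (sizeSum ps) ps (m*2≡1+n⇒1≤m e)
    (Equivalence.from T-∧ (descending⇒allValid ps d , descending⇒nonIncr ps d) , refl)
    (All.map (λ {p} → code≤⇒size< e p) (descending⇒bounded ps d))
    (trans (sym e) (m*2≡m+m (sizeSum ps)))
  from : RhoC (suc n) → CubicUpTo n (suc n)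
  from (mkRhoC l ps _ (c , s≡l) below total) = ps , descending ps c below , ps*2≡1+n
    where
    l*2≡1+n : l ℕ.* 2 ≡ suc n
    l*2≡1+n = trans (m*2≡m+m l) (sym (trans total (cong (λ x → l ℕ.+ x) s≡l)))
    ps*2≡1+n : sizeSum ps ℕ.* 2 ≡ suc n
    ps*2≡1+n = trans (cong (ℕ._* 2) s≡l) l*2≡1+n
    descending : ∀ ps → T (allValid ps ∧ nonIncr ps) → All (λ p → proj₁ p < l) ps → DescendingFrom n ps
    descending []       _ _         = _
    descending (p ∷ qs) c (p<l ∷ _) = cubic⇒descending p qs (proj₁ (Equivalence.to T-∧ c))
                                        (proj₂ (Equivalence.to T-∧ c)) (size<⇒code≤ l*2≡1+n p p<l)
  size≡ : ∀ r → RhoC.largest (to (from r)) ≡ RhoC.largest r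
  size≡ (mkRhoC l ps _ (c , s≡l) below total) = s≡l

finiteRhoC : ∀ n → Finite (RhoC n)
finiteRhoC zero    = finite-empty λ { (mkRhoC (suc _) _ _ _ _ ()) }
finiteRhoC (suc n) = finite-↔ (finiteCubicUpTo n (suc n)) (cubicUpTo↔RhoC n)

rhoC : ℕ → ℕ
rhoC n = proj₁ (finiteRhoC n)

correction : Series
correction = (+ 2) ⊙ inv1 (one ⊖ mono 2) ⊖ mono 6 ⊛ inv1 (one ⊖ mono 4) ⊖ one ⊖ mono 2

correction-coefficient : ∀ n → correction n ≡ + 2 * geometric 2 n - (mono 6 ⊛ geometric 4) n - one n - mono 2 n
correction-coefficient n =
  cong₂ (λ a b → + 2 * a - b - one n - mono 2 n) (inv1-geometric 2 n) (⊛-congʳ (mono 6) (inv1-geometric 4) n)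

data Parity : ℕ → Set where
  even : ∀ m → Parity (m ℕ.* 2)
  odd  : ∀ m → Parity (suc (m ℕ.* 2))

parity : ∀ n → Parity n
parity zero = even 0
parity (suc n) with parity n
... | even m = odd m
... | odd  m = even (suc m)

correction-odd : ∀ m → correction (suc (m ℕ.* 2)) ≡ + 0
correction-odd 0 = refl
correction-odd 1 = refl
correction-odd 2 = refl
correction-odd (suc (suc (suc m))) = begin
  correction n
    ≡⟨ correction-coefficient n ⟩
  + 2 * one (n % 2) - (mono 6 ⊛ geometric 4) n - + 0 - + 0
    ≡⟨ cong₂ (λ a b → + 2 * one a - b - + 0 - + 0) ([m+kn]%n≡m%n 1 (3 ℕ.+ m) 2)
             (mono-⊛-≤ (geometric 4) (ℕ.m≤m+n 6 (suc (m ℕ.* 2)))) ⟩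
  + 2 * + 0 - one (suc (m ℕ.* 2) % 4) - + 0 - + 0
    ≡⟨ cong (λ a → + 2 * + 0 - a - + 0 - + 0) (odd-mod4 m) ⟩
  + 0 ∎
  where
  n = suc (suc (suc (suc m)) ℕ.* 2)
  odd-mod4 : ∀ m → one (suc (m ℕ.* 2) % 4) ≡ + 0
  odd-mod4 0 = refl
  odd-mod4 1 = refl
  odd-mod4 (suc (suc m)) = odd-mod4 m

colourCount : ℕ → ℕ
colourCount s = validCount (s , false) ℕ.+ validCount (s , true)

correction-even : ∀ l → correction (suc l ℕ.* 2) ≡ + colourCount (suc l)
correction-even 0 = refl
correction-even 1 = refl
correction-even (suc (suc k)) = begin
  correction n
    ≡⟨ correction-coefficient n ⟩
  + 2 * one (n % 2) - (mono 6 ⊛ geometric 4) n - + 0 - + 0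
    ≡⟨ cong₂ (λ a b → + 2 * one a - b - + 0 - + 0)
             (m*n%n≡0 (3 ℕ.+ k) 2) (mono-⊛-≤ (geometric 4) (ℕ.m≤m+n 6 (k ℕ.* 2))) ⟩
  + 2 * + 1 - one ((k ℕ.* 2) % 4) - + 0 - + 0
    ≡⟨ even-mod4 k ⟩
  + colourCount (3 ℕ.+ k) ∎
  where
  n = suc (suc (suc k)) ℕ.* 2
  -- For λ = k + 3, exactly one of 2 ∣ λ and 4 ∣ 2λ − 6 holds.
  even-mod4 : ∀ k → + 2 * + 1 - one ((k ℕ.* 2) % 4) - + 0 - + 0 ≡ + colourCount (3 ℕ.+ k)
  even-mod4 0 = refl
  even-mod4 1 = refl
  even-mod4 (suc (suc k)) = even-mod4 k

cubicCount≡rhoC+colourCount : ∀ l →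
  cubicCount (suc (suc l ℕ.* 2)) (suc l ℕ.* 2) ≡ rhoC (suc l ℕ.* 2) ℕ.+ colourCount (suc l)
cubicCount≡rhoC+colourCount l = begin
  cubicCount (suc n) n
    ≡⟨ cubicCount-top n (cong (λ p → suc (proj₁ p) ℕ.* 2) (decode-odd l)) ⟩
  cubicCount n n ℕ.+ validCount (map₁ suc (decode (suc (l ℕ.* 2))))
    ≡⟨ cong₂ ℕ._+_ (cubicCount-top (suc (l ℕ.* 2)) (cong (λ p → suc (proj₁ p) ℕ.* 2) (decode-even l)))
                   (cong (validCount ∘ map₁ suc) (decode-odd l)) ⟩
  rhoC n ℕ.+ validCount (map₁ suc (decode (l ℕ.* 2))) ℕ.+ validCount (suc l , true)
    ≡⟨ cong (λ p → rhoC n ℕ.+ validCount (map₁ suc p) ℕ.+ validCount (suc l , true)) (decode-even l) ⟩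
  rhoC n ℕ.+ validCount (suc l , false) ℕ.+ validCount (suc l , true)
    ≡⟨ ℕ.+-assoc (rhoC n) (validCount (suc l , false)) (validCount (suc l , true)) ⟩
  rhoC n ℕ.+ colourCount (suc l) ∎
  where
  n = suc l ℕ.* 2

cubicCount≡rhoC+correction : ∀ n → + cubicCount (suc n) n ≡ + rhoC n + correction n
cubicCount≡rhoC+correction n with parity n
... | even zero    = cong +_ (cubicCount-at-0 1)
... | even (suc l) = begin
  + cubicCount (suc N) N              ≡⟨ cong +_ (cubicCount≡rhoC+colourCount l) ⟩
  + (rhoC N ℕ.+ colourCount (suc l))  ≡⟨ ℤ.pos-+ (rhoC N) (colourCount (suc l)) ⟩
  + rhoC N + + colourCount (suc l)    ≡⟨ cong (λ c → + rhoC N + c) (sym (correction-even l)) ⟩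
  + rhoC N + correction N             ∎
  where N = suc l ℕ.* 2
... | odd m        = begin
  + cubicCount (suc N) N   ≡⟨ cong +_ (cubicCount-odd (suc n) m) ⟩
  + 0                      ≡⟨ cong₂ (λ a b → + a + b) (sym (cubicCount-odd (m ℕ.* 2) m))
                                                      (sym (correction-odd m)) ⟩
  + rhoC N + correction N  ∎
  where N = suc (m ℕ.* 2)

rhs≡rhoC : ∀ n → rhs n ≡ + rhoC n
rhs≡rhoC n = begin
  rhs n
    ≡⟨ regroup (inv1 (qPoch 2 ⊛ qPoch 4) n) (+ 2 * inv1 (one ⊖ mono 2) n)
               ((mono 6 ⊛ inv1 (one ⊖ mono 4)) n) (one n) (mono 2 n) ⟩
  inv1 (qPoch 2 ⊛ qPoch 4) n - correction n
    ≡⟨ cong (_- correction n) (trans (inv1-qPoch n) (cubicCount≡rhoC+correction n)) ⟩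
  + rhoC n + correction n - correction n
    ≡⟨ m+n-n≡m (+ rhoC n) (correction n) ⟩
  + rhoC n ∎
  where
  regroup : ∀ a b c d e → a - b + c + d + e ≡ a - (b - c - d - e)
  regroup = solve-∀

theorem1p5 : (n : ℕ) → Σ ℕ (λ k → (Fin k ↔ RhoC n) × (+ k ≡ rhs n))
theorem1p5 n = rhoC n , proj₂ (finiteRhoC n) , sym (rhs≡rhoC n)
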